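{- Let $\mathcal V$ be a unital commutative quantale, $F\colon\mathsf{Set}\to\mathsf{Set}$ a functor, $\bar F$ a lifting of $F$ to $\mathcal V\text{ - }\mathsf{Rel}$, $\xi\colon X\to FX$ a function, and $b\colon\mathcal V\text{ - }\mathsf{Rel}_X\to\mathcal V\text{ - }\mathsf{Rel}_X$ given by $b(d)=\bar F(d)\circ(\xi\times\xi)$. Let $f_1,f_2\colon\mathcal V\text{ - }\mathsf{Rel}_X\to\mathcal V\text{ - }\mathsf{Rel}_X$ be monotone maps that are $b$-compatible. If $\bar F(p; q)\ge\bar F(p);\bar F(q)$ for all $p,q\in\mathcal V\text{ - }\mathsf{Rel}_X$, then the map $f_1; f_2$, defined by $(f_1;f_2)(d)=f_1(d);f_2(d)$, is $b$-compatible.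
   Context: A unital commutative quantale $\mathcal V$ is a complete lattice $(\mathcal V,\le)$ with an associative, commutative operation $\otimes$ distributing over arbitrary joins $\bigvee$, with unit $1$. $\mathcal V\text{ - }\mathsf{Rel}_X$ denotes the complete lattice of maps $X\times X\to\mathcal V$ with the pointwise order. A lifting of $F$ to $\mathcal V\text{ - }\mathsf{Rel}$ assigns to each $r\in\mathcal V\text{ - }\mathsf{Rel}_X$ a relation $\bar F(r)\in\mathcal V\text{ - }\mathsf{Rel}_{FX}$ such that whenever $f\colon X\to Y$ satisfies $r\le q\circ(f\times f)$ then $\bar F(r)\le\bar F(q)\circ(Ff\times Ff)$. Composition of relations: $(p;q)(x,y)=\bigvee_{z\in X}p(x,z)\otimes q(z,y)$. A monotone map $f$ on $\mathcal V\text{ - }\mathsf{Rel}_X$ is $b$-compatible if $f(b(d))\le b(f(d))$ for all $d$. -}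

module Defs where

open import Level using (0ℓ)
open import Function using (id; _∘_)
open import Relation.Binary.PropositionalEquality using (_≡_)
open import Relation.Binary.Structures using (IsPartialOrder)
open import Data.Product using (Σ; _,_)

record Quantale : Set₁ where
  infix  4 _≤_
  infixl 7 _⊗_
  field
    Carrier        : Set
    _≤_            : Carrier → Carrier → Set
    isPartialOrder : IsPartialOrder _≡_ _≤_
    ⋁              : {I : Set} → (I → Carrier) → Carrier
    ⋁-upper        : {I : Set} (f : I → Carrier) (i : I) → f i ≤ ⋁ f
    ⋁-least        : {I : Set} (f : I → Carrier) (a : Carrier) →
                     ((i : I) → f i ≤ a) → ⋁ f ≤ a
    _⊗_            : Carrier → Carrier → Carrier
    𝟙              : Carrier
    ⊗-assoc        : ∀ a b c → (a ⊗ b) ⊗ c ≡ a ⊗ (b ⊗ c)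
    ⊗-comm         : ∀ a b → a ⊗ b ≡ b ⊗ a
    ⊗-identityˡ    : ∀ a → 𝟙 ⊗ a ≡ a
    ⊗-distribˡ-⋁   : ∀ a {I : Set} (f : I → Carrier) →
                     a ⊗ ⋁ f ≡ ⋁ (λ i → a ⊗ f i)

record Functor : Set₁ where
  field
    F₀   : Set → Set
    F₁   : {A B : Set} → (A → B) → F₀ A → F₀ B
    F-id : {A : Set} (x : F₀ A) → F₁ id x ≡ x
    F-∘  : {A B C : Set} (g : B → C) (f : A → B) (x : F₀ A) →
           F₁ (g ∘ f) x ≡ F₁ g (F₁ f x)

module _ (Q : Quantale) where
  open Quantale Q

  VRel : Set → Set
  VRel X = X → X → Carrier

  _≤R_ : {X : Set} → VRel X → VRel X → Set
  r ≤R q = ∀ x y → r x y ≤ q x y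

  _⨾_ : {X : Set} → VRel X → VRel X → VRel X
  _⨾_ {X} p q x y = ⋁ {X} (λ z → p x z ⊗ q z y)

  reindex : {X Y : Set} → (X → Y) → VRel Y → VRel X
  reindex f q x y = q (f x) (f y)

  record Lifting (F : Functor) : Set₁ where
    open Functor F
    field
      F̄       : {X : Set} → VRel X → VRel (F₀ X)
      F̄-lifts : {X Y : Set} (f : X → Y) (r : VRel X) (q : VRel Y) →
                r ≤R reindex f q → F̄ r ≤R reindex (F₁ f) (F̄ q)

  Monotone : {X : Set} → (VRel X → VRel X) → Set
  Monotone {X} f = (d d' : VRel X) → d ≤R d' → f d ≤R f d'

  Compatible : {X : Set} → (b f : VRel X → VRel X) → Set
  Compatible {X} b f = (d : VRel X) → f (b d) ≤R b (f d)

  bMap : {F : Functor} → Lifting F → {X : Set} → (X → Functor.F₀ F X) →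
         VRel X → VRel X
  bMap L ξ d = reindex ξ (Lifting.F̄ L d)

  _⨾ᶠ_ : {X : Set} → (VRel X → VRel X) → (VRel X → VRel X) → VRel X → VRel X
  (f₁ ⨾ᶠ f₂) d = f₁ d ⨾ f₂ d

module Submission where

open import Defs
open import Data.Bool using (Bool; true; false)
open import Relation.Binary.PropositionalEquality using (_≡_; sym; subst; subst₂)
open import Relation.Binary.Structures using (IsPartialOrder)

-- Compatibility of f₁ and f₂ bounds (f₁ ; f₂)(b d) by b(f₁ d) ; b(f₂ d), and
-- pulling the composition through the reindexing along ξ and then through the
-- lax lifting gives b(f₁ d ; f₂ d).

module QuantaleProperties (Q : Quantale) where
  open Quantale Q
  open IsPartialOrder isPartialOrder using (antisym)
    renaming (refl to ≤-refl; trans to ≤-trans)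

  private
    pair : Carrier → Carrier → Bool → Carrier
    pair a a' true  = a
    pair a a' false = a'

    ⋁-pair-≤ : ∀ {a a'} → a ≤ a' → ⋁ (pair a a') ≡ a'
    ⋁-pair-≤ le = antisym (⋁-least _ _ λ { true → le ; false → ≤-refl })
                          (⋁-upper _ false)

  -- Monotonicity of ⊗ comes from distributivity: with a ∨ a' the join of pair a a',
  -- c ⊗ a' = c ⊗ (a ∨ a') ≥ c ⊗ a.
  ⊗-monoʳ-≤ : ∀ c {a a'} → a ≤ a' → c ⊗ a ≤ c ⊗ a'
  ⊗-monoʳ-≤ c {a} {a'} le =
    subst (c ⊗ a ≤_) c⊗pair≡c⊗a' (⋁-upper (λ i → c ⊗ pair a a' i) true)
    where
    c⊗pair≡c⊗a' : ⋁ (λ i → c ⊗ pair a a' i) ≡ c ⊗ a'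
    c⊗pair≡c⊗a' = subst (λ t → ⋁ (λ i → c ⊗ pair a a' i) ≡ c ⊗ t) (⋁-pair-≤ le)
                   (sym (⊗-distribˡ-⋁ c (pair a a')))

  ⊗-monoˡ-≤ : ∀ c {a a'} → a ≤ a' → a ⊗ c ≤ a' ⊗ c
  ⊗-monoˡ-≤ c {a} {a'} le =
    subst₂ _≤_ (⊗-comm c a) (⊗-comm c a') (⊗-monoʳ-≤ c le)

  ⊗-mono-≤ : ∀ {a a' b b'} → a ≤ a' → b ≤ b' → a ⊗ b ≤ a' ⊗ b'
  ⊗-mono-≤ {a' = a'} {b = b} p q = ≤-trans (⊗-monoˡ-≤ b p) (⊗-monoʳ-≤ a' q)

module RelationProperties (Q : Quantale) where
  open Quantale Q
  open QuantaleProperties Q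
  open IsPartialOrder isPartialOrder using () renaming (trans to ≤-trans)

  ≤R-trans : {X : Set} {p q r : VRel Q X} →
             _≤R_ Q p q → _≤R_ Q q r → _≤R_ Q p r
  ≤R-trans p≤q q≤r x y = ≤-trans (p≤q x y) (q≤r x y)

  ⨾-mono-≤R : {X : Set} {p p' q q' : VRel Q X} →
              _≤R_ Q p p' → _≤R_ Q q q' → _≤R_ Q (_⨾_ Q p q) (_⨾_ Q p' q')
  ⨾-mono-≤R p≤p' q≤q' x y =
    ⋁-least _ _ λ z → ≤-trans (⊗-mono-≤ (p≤p' x z) (q≤q' z y))
                              (⋁-upper _ z)

  -- A join over X is bounded by the join over the larger index set Y ⊇ ξ[X].
  reindex-⨾-≤R : {X Y : Set} (ξ : X → Y) (p q : VRel Q Y) →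
                 _≤R_ Q (_⨾_ Q (reindex Q ξ p) (reindex Q ξ q))
                        (reindex Q ξ (_⨾_ Q p q))
  reindex-⨾-≤R ξ p q x y =
    ⋁-least _ _ λ z → ⋁-upper (λ w → p (ξ x) w ⊗ q w (ξ y)) (ξ z)

proposition23 : (Q : Quantale) (F : Functor) (L : Lifting Q F) (X : Set)
    (ξ : X → Functor.F₀ F X) (f₁ f₂ : VRel Q X → VRel Q X) →
    Monotone Q f₁ → Monotone Q f₂ →
    Compatible Q (bMap Q L ξ) f₁ → Compatible Q (bMap Q L ξ) f₂ →
    ((p q : VRel Q X) →
      _≤R_ Q (_⨾_ Q (Lifting.F̄ L p) (Lifting.F̄ L q)) (Lifting.F̄ L (_⨾_ Q p q))) →
    Compatible Q (bMap Q L ξ) (_⨾ᶠ_ Q f₁ f₂)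
proposition23 Q F L X ξ f₁ f₂ _ _ compat₁ compat₂ F̄-lax d =
  ≤R-trans (⨾-mono-≤R (compat₁ d) (compat₂ d))
  (≤R-trans (reindex-⨾-≤R ξ (F̄ (f₁ d)) (F̄ (f₂ d)))
            (λ x y → F̄-lax (f₁ d) (f₂ d) (ξ x) (ξ y)))
  where
  open Lifting L
  open RelationProperties Q
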